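{- For $n\ge 1$ let $L(n,2)$ be the double loopy star with $n$ outer vertices. In the Strings-and-Coins game under optimal play: on $L(1,2)$ the game is a tie; on $L(2,2)$ Player 2 wins by exactly one point; and for $n\ge 3$, Player 2 wins on $L(n,2)$ by exactly two points when $n$ is odd and by exactly three points when $n$ is even. In particular Player 2 wins on $L(n,2)$ for every $n\ge 2$.
   Context: Strings-and-Coins game: played on a finite multigraph (loops and parallel edges allowed) in which every vertex initially has at least one incident edge. Two players, Player 1 moving first, alternately remove one edge (a loop counts as one edge). Whenever a removal leaves one or more vertices with no incident edges, the mover earns one point for each such vertex and must move again, provided edges remain. The game ends when no edges remain; a player wins if they have more points, and it is a tie if scores are equal. Optimal play means each player maximizes (own final score) minus (opponent's final score). "Player X wins by $k$ points" means that under optimal play the final score of X exceeds the opponent's by exactly $k$. The double loopy star $L(n,2)$ has a central vertex $c$ (with no loop) and $n$ outer vertices $v_1,\dots,v_n$; for each $i$ there is one edge $cv_i$ and two loops at $v_i$, and there are no other edges. -}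

module Defs where

open import Data.Nat using (ℕ; zero; suc)
open import Data.Integer using (ℤ; +_; -_; _+_; _⊔_)
open import Data.Fin using (Fin; zero; suc; _≟_)
open import Data.Vec using (Vec; []; _∷_; lookup; removeAt; concat; tabulate; foldr)
open import Data.Product using (_×_; _,_; proj₁; proj₂)
open import Data.Bool using (Bool; true; false; not; _∨_; _∧_; if_then_else_)
open import Relation.Nullary.Decidable using (isYes)

-- A finite multigraph on vertex set Fin V is given by a vector of edges;
-- an edge is an (unordered) pair of endpoints; a loop is an edge (v , v).
Edge : ℕ → Set
Edge V = Fin V × Fin V

incident : ∀ {V} → Fin V → Edge V → Bool
incident v (a , b) = isYes (v ≟ a) ∨ isYes (v ≟ b)

isolated : ∀ {V k} → Fin V → Vec (Edge V) k → Bool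
isolated v es = foldr _ (λ e acc → not (incident v e) ∧ acc) true es

b2n : Bool → ℕ
b2n true = 1
b2n false = 0

-- number of points earned when edge e is removed and es' are the remaining
-- edges: the endpoints of e (counted once each) left with no incident edge.
captured : ∀ {V k} → Edge V → Vec (Edge V) k → ℕ
captured (a , b) es' with isYes (a ≟ b)
... | true  = b2n (isolated a es')
... | false = b2n (isolated a es') Data.Nat.+ b2n (isolated b es')

maxFin : ∀ {k} → (Fin (suc k) → ℤ) → ℤ
maxFin {zero}  f = f zero
maxFin {suc k} f = f zero ⊔ maxFin (λ i → f (suc i))

-- Optimal value of the position with remaining edges es, from the point of
-- view of the player about to move: (mover's future points) − (opponent's
-- future points) under optimal play (both maximise their own difference).
-- After removing an edge: if some vertex is captured the mover scores and
-- moves again (if edges remain), otherwise the turn passes.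
value : ∀ {V} k → Vec (Edge V) k → ℤ
value zero    []  = + 0
value (suc k) es  = maxFin (λ i → step (lookup es i) (removeAt es i))
  where
  step : _ → Vec _ k → ℤ
  step e es' with captured e es'
  ... | zero  = - value k es'
  ... | suc c = + suc c + value k es'

-- The double loopy star L(n,2): vertex zero is the centre c, vertex suc i is
-- the outer vertex v_{i+1}; for each i one edge c v_i and two loops at v_i.
loopyStar2 : (n : ℕ) → Vec (Edge (suc n)) (n Data.Nat.* 3)
loopyStar2 n = concat (tabulate λ i → (zero , suc i) ∷ (suc i , suc i) ∷ (suc i , suc i) ∷ [])

-- Optimal score difference (Player 1 minus Player 2) on L(n,2).
gameValueL : ℕ → ℤ
gameValueL n = value (n Data.Nat.* 3) (loopyStar2 n)

{-# OPTIONS --safe #-}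
-- A position reachable from L(n,2) is determined, up to renaming the arms, by its census: how
-- many arms are in each of the six states (spoke present or not, 0, 1 or 2 loops left), and each
-- edge removal moves one arm from one state to another. The value of a census is its number of
-- coins (spoke₀ and loops₁ arms, whose outer vertex hangs on a single edge) plus a correction that
-- depends only on the class of the census, where each count is taken in a cyclic-monoid quotient
-- of ℕ. This value satisfies the optimality equations of the game: no move does better, and some
-- move attains it. Since every move shifts the coins by a fixed amount, both facts reduce to
-- finitely many conditions on classes, which are checked by evaluation; induction on the number
-- of edges then identifies the value with the game value.

module Submission where

open import Defs
open import Data.Bool as Bool using (Bool; true; false; not; _∧_; _∨_; T; if_then_else_)
open import Data.Bool.Properties using (∧-zeroʳ; ∨-identityʳ; T-∧; T-≡)
open import Data.Fin using (Fin; zero; suc; inject₁; toℕ; _≟_)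
open import Data.Fin.Properties using (toℕ-inject₁; suc-injective)
open import Data.Integer as ℤ using (ℤ; +_; -_; -[1+_]; _<_; 0ℤ; 1ℤ; -1ℤ)
import Data.Integer.Properties as ℤₚ
open import Data.Integer.Tactic.RingSolver using (solve-∀)
open import Data.Bool.ListAction using (all; any)
open import Data.List using (List; []; _∷_; upTo)
open import Data.List.Membership.Propositional using (_∈_; lose)
open import Data.List.Membership.Propositional.Properties using (∈-upTo⁺)
import Data.List.Relation.Unary.All as Listᴬ
open import Data.List.Relation.Unary.All.Properties using (all⁺)
open import Data.List.Relation.Unary.Any using (here; there; satisfied)
open import Data.List.Relation.Unary.Any.Properties using (any⁺; any⁻)
open import Data.Nat as ℕ using (ℕ; zero; suc; _+_; _≤_; _%_; z≤n; s≤s)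
import Data.Nat.Properties as ℕₚ
open import Data.Nat.DivMod using (m%n<n; m%n≤m; m%n%n≡m%n; %-distribˡ-+)
open import Algebra.Properties.CommutativeSemigroup ℕₚ.+-commutativeSemigroup using (x∙yz≈y∙xz; x∙yz≈yx∙z; xy∙z≈zy∙x; interchange)
open import Data.Product using (∃; ∃-syntax; _×_; _,_; proj₁; proj₂)
open import Data.Product.Properties using (≡-dec)
import Data.Vec as Vec
open import Data.Vec using (Vec; []; _∷_; _++_; concat; lookup; removeAt; replicate; tabulate; sum; count; countᵇ; _[_]≔_)
open import Data.Vec.Properties using (lookup∘update; lookup∘update′; lookup-replicate; tabulate∘lookup; tabulate-cong)
open import Data.Vec.Relation.Binary.Pointwise.Inductive using (Pointwise; []; _∷_)
open import Data.Vec.Relation.Unary.All using (All; []; _∷_)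
open import Data.Vec.Relation.Unary.All.Properties using (lookup⁺; concat⁺; tabulate⁺)
open import Function using (_∘_; Equivalence)
open import Relation.Binary.Definitions using (DecidableEquality)
open import Relation.Binary.PropositionalEquality
open import Relation.Nullary using (Dec; yes; no; does; contradiction)
open import Relation.Nullary.Decidable using (dec-true; dec-false; T?; isYes; toWitness)
open import Relation.Unary using (Pred; Decidable)

-- Game values as maxima

moveOutcome : ℕ → ℤ → ℤ
moveOutcome zero    v = - v
moveOutcome (suc c) v = + suc c ℤ.+ v

maxFin-upper : ∀ {k} (f : Fin (suc k) → ℤ) i → f i ℤ.≤ maxFin f
maxFin-upper {zero}  f zero    = ℤₚ.≤-refl
maxFin-upper {suc k} f zero    = ℤₚ.i≤i⊔j (f zero) _
maxFin-upper {suc k} f (suc i) = ℤₚ.≤-trans (maxFin-upper (f ∘ suc) i) (ℤₚ.i≤j⊔i (f zero) _)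

maxFin-least : ∀ {k} {f : Fin (suc k) → ℤ} {M} → (∀ i → f i ℤ.≤ M) → maxFin f ℤ.≤ M
maxFin-least {zero}  f≤M = f≤M zero
maxFin-least {suc k} f≤M = ℤₚ.⊔-lub (f≤M zero) (maxFin-least (f≤M ∘ suc))

maxFin-≡ : ∀ {k} {f : Fin (suc k) → ℤ} {M} → (∀ i → f i ℤ.≤ M) → (∃ λ i → f i ≡ M) → maxFin f ≡ M
maxFin-≡ {f = f} f≤M (i , fi≡M) =
  ℤₚ.≤-antisym (maxFin-least f≤M) (subst (ℤ._≤ maxFin f) fi≡M (maxFin-upper f i))

-- The summands of value (suc k) es are a where-bound function of Defs; unification recovers them.
valueSummands : ∀ {V} k (es : Vec (Edge V) (suc k)) → ∃ λ (f : Fin (suc k) → ℤ) → value (suc k) es ≡ maxFin f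
valueSummands k es = _ , refl

removalValue : ∀ {V} k (es : Vec (Edge V) (suc k)) → Fin (suc k) → ℤ
removalValue k es = proj₁ (valueSummands k es)

removalValue-≡ : ∀ {V} k (es : Vec (Edge V) (suc k)) i →
                 removalValue k es i ≡ moveOutcome (captured (lookup es i) (removeAt es i)) (value k (removeAt es i))
removalValue-≡ k es i with captured (lookup es i) (removeAt es i)
... | zero  = refl
... | suc _ = refl

-- Counting in vectors

All-removeAt : ∀ {a p n} {A : Set a} {P : Pred A p} {xs : Vec A (suc n)} → All P xs → ∀ i → All P (removeAt xs i)
All-removeAt (_ ∷ pxs)                    zero    = pxs
All-removeAt {xs = _ ∷ _ ∷ _} (px ∷ pxs) (suc i) = px ∷ All-removeAt pxs i

module _ {a p} {A : Set a} {P : Pred A p} (P? : Decidable P) where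

  χ : A → ℕ
  χ x = b2n (does (P? x))

  count-∷ : ∀ {n} x (xs : Vec A n) → count P? (x ∷ xs) ≡ χ x + count P? xs
  count-∷ x xs with does (P? x)
  ... | true  = refl
  ... | false = refl

  count-removeAt : ∀ {n} (xs : Vec A (suc n)) i →
                   count P? xs ≡ χ (lookup xs i) + count P? (removeAt xs i)
  count-removeAt (x ∷ xs)          zero    = count-∷ x xs
  count-removeAt (x ∷ xs@(_ ∷ _)) (suc i) = begin
    count P? (x ∷ xs)                                   ≡⟨ count-∷ x xs ⟩
    χ x + count P? xs                                   ≡⟨ cong (_+_ (χ x)) (count-removeAt xs i) ⟩
    χ x + (χ (lookup xs i) + count P? (removeAt xs i))  ≡⟨ x∙yz≈y∙xz (χ x) (χ (lookup xs i)) _ ⟩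
    χ (lookup xs i) + (χ x + count P? (removeAt xs i))  ≡⟨ cong (_+_ (χ (lookup xs i))) (count-∷ x (removeAt xs i)) ⟨
    χ (lookup xs i) + count P? (x ∷ removeAt xs i)      ∎
    where open ≡-Reasoning

  lookup⇒count-nonZero : ∀ {n} (xs : Vec A n) i → P (lookup xs i) → ℕ.NonZero (count P? xs)
  lookup⇒count-nonZero (x ∷ xs) zero    px with P? x
  ... | yes _  = _
  ... | no ¬px = contradiction px ¬px
  lookup⇒count-nonZero (x ∷ xs) (suc i) pxᵢ with does (P? x)
  ... | true  = _
  ... | false = lookup⇒count-nonZero xs i pxᵢ

  count-nonZero⇒lookup : ∀ {n} (xs : Vec A n) → ℕ.NonZero (count P? xs) → ∃ λ i → P (lookup xs i)
  count-nonZero⇒lookup (x ∷ xs) nonZero with P? x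
  ... | yes px = zero , px
  ... | no _   = let i , pxᵢ = count-nonZero⇒lookup xs nonZero in suc i , pxᵢ

  count-[]≔ : ∀ {n} (xs : Vec A n) i y → count P? (xs [ i ]≔ y) + χ (lookup xs i) ≡ count P? xs + χ y
  count-[]≔ (x ∷ xs) zero y = begin
    count P? (y ∷ xs) + χ x  ≡⟨ cong (_+ χ x) (count-∷ y xs) ⟩
    χ y + count P? xs + χ x  ≡⟨ xy∙z≈zy∙x (χ y) (count P? xs) (χ x) ⟩
    χ x + count P? xs + χ y  ≡⟨ cong (_+ χ y) (count-∷ x xs) ⟨
    count P? (x ∷ xs) + χ y  ∎
    where open ≡-Reasoning
  count-[]≔ (x ∷ xs) (suc i) y = begin
    count P? (x ∷ (xs [ i ]≔ y)) + χ (lookup xs i)    ≡⟨ cong (_+ χ (lookup xs i)) (count-∷ x (xs [ i ]≔ y)) ⟩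
    χ x + count P? (xs [ i ]≔ y) + χ (lookup xs i)    ≡⟨ ℕₚ.+-assoc (χ x) _ _ ⟩
    χ x + (count P? (xs [ i ]≔ y) + χ (lookup xs i))  ≡⟨ cong (_+_ (χ x)) (count-[]≔ xs i y) ⟩
    χ x + (count P? xs + χ y)                          ≡⟨ ℕₚ.+-assoc (χ x) _ _ ⟨
    χ x + count P? xs + χ y                            ≡⟨ cong (_+ χ y) (count-∷ x xs) ⟨
    count P? (x ∷ xs) + χ y                            ∎
    where open ≡-Reasoning

  count-++ : ∀ {m n} (xs : Vec A m) (ys : Vec A n) → count P? (xs ++ ys) ≡ count P? xs + count P? ys
  count-++ []       ys = refl
  count-++ (x ∷ xs) ys = begin
    count P? (x ∷ xs ++ ys)            ≡⟨ count-∷ x (xs ++ ys) ⟩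
    χ x + count P? (xs ++ ys)          ≡⟨ cong (_+_ (χ x)) (count-++ xs ys) ⟩
    χ x + (count P? xs + count P? ys)  ≡⟨ ℕₚ.+-assoc (χ x) _ _ ⟨
    χ x + count P? xs + count P? ys    ≡⟨ cong (_+ count P? ys) (count-∷ x xs) ⟨
    count P? (x ∷ xs) + count P? ys    ∎
    where open ≡-Reasoning

  count-concat : ∀ {m k} (f : Fin m → Vec A k) → count P? (concat (tabulate f)) ≡ sum (tabulate (count P? ∘ f))
  count-concat {zero}  f = refl
  count-concat {suc m} f = trans (count-++ (f zero) _) (cong (_+_ (count P? (f zero))) (count-concat (f ∘ suc)))

  count-replicate : ∀ n x → count P? (replicate n x) ≡ (if does (P? x) then n else 0)
  count-replicate zero    x with does (P? x)
  ... | true  = refl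
  ... | false = refl
  count-replicate (suc n) x with does (P? x) in eq
  ... | true  = cong suc (trans (count-replicate n x) (cong (if_then n else 0) eq))
  ... | false = trans (count-replicate n x) (cong (if_then n else 0) eq)

sum-tabulate-const : ∀ n c → sum (tabulate {n = n} λ _ → c) ≡ n ℕ.* c
sum-tabulate-const zero    c = refl
sum-tabulate-const (suc n) c = cong (_+_ c) (sum-tabulate-const n c)

sum-single : ∀ {n} (f : Fin n → ℕ) j → (∀ i → j ≢ i → f i ≡ 0) → sum (tabulate f) ≡ f j
sum-single {suc n} f zero    f≡0 = begin
  f zero + sum (tabulate (f ∘ suc))  ≡⟨ cong (_+_ (f zero) ∘ sum) (tabulate-cong λ i → f≡0 (suc i) λ ()) ⟩
  f zero + sum (tabulate {n = n} λ _ → 0)  ≡⟨ cong (_+_ (f zero)) (trans (sum-tabulate-const n 0) (ℕₚ.*-zeroʳ n)) ⟩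
  f zero + 0                         ≡⟨ ℕₚ.+-identityʳ (f zero) ⟩
  f zero                             ∎
  where open ≡-Reasoning
sum-single {suc n} f (suc j) f≡0 =
  cong₂ _+_ (f≡0 zero λ ()) (sum-single (f ∘ suc) j λ i j≢i → f≡0 (suc i) (j≢i ∘ suc-injective))

-- Star positions

-- Arm j of a loopy star: whether the spoke c v_j is still present, and how many loops (at most K) remain at v_j.
Arm : ℕ → Set
Arm K = Bool × Fin (suc K)

pattern empty = false , zero

_≟ₐ_ : ∀ {K} → DecidableEquality (Arm K)
_≟ₐ_ = ≡-dec Bool._≟_ _≟_

_≟ₑ_ : ∀ {V} → DecidableEquality (Edge V)
_≟ₑ_ = ≡-dec _≟_ _≟_

data Move (K : ℕ) : Set where
  cutSpoke : Fin (suc K) → Move K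
  cutLoop  : Bool → Fin K → Move K

module _ {K : ℕ} where

  source target : Move K → Arm K
  source (cutSpoke l)  = true , l
  source (cutLoop s l) = s , suc l
  target (cutSpoke l)  = false , l
  target (cutLoop s l) = s , inject₁ l

  cutsSpoke : Move K → Bool
  cutsSpoke (cutSpoke _)  = true
  cutsSpoke (cutLoop _ _) = false

  removedEdge : ∀ {n} → Move K → Fin n → Edge (suc n)
  removedEdge (cutSpoke _)  j = zero , suc j
  removedEdge (cutLoop _ _) j = suc j , suc j

  play : ∀ {n} → Vec (Arm K) n → Fin n → Move K → Vec (Arm K) n
  play p j m = p [ j ]≔ target m

  spokeArms : ∀ {n} → Vec (Arm K) n → ℕ
  spokeArms = countᵇ proj₁

  -- Vertices captured by m, given the number of arms that keep their spoke afterwards.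
  captures : Move K → ℕ → ℕ
  captures m spokesLeft = b2n (cutsSpoke m ∧ (spokesLeft ℕ.≡ᵇ 0)) + b2n (does (target m ≟ₐ empty))

target≢source : ∀ {K} (m : Move K) → target m ≢ source m
target≢source (cutSpoke _)  eq = contradiction (cong proj₁ eq) λ ()
target≢source (cutLoop _ l) eq = ℕₚ.1+n≢n (sym (trans (sym (toℕ-inject₁ l)) (cong (toℕ ∘ proj₂) eq)))

source≢empty : ∀ {K} (m : Move K) → source m ≢ empty
source≢empty (cutSpoke _)  eq = contradiction (cong proj₁ eq) λ ()
source≢empty (cutLoop _ _) eq = contradiction (cong proj₂ eq) λ ()

withSpoke : ∀ {K} (a : Arm K) → ℕ.NonZero (b2n (proj₁ a)) → a ≡ source (cutSpoke (proj₂ a))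
withSpoke (true , _) _ = refl

withLoop : ∀ {K} (a : Arm K) → ℕ.NonZero (toℕ (proj₂ a)) → ∃ λ l → a ≡ source (cutLoop (proj₁ a) l)
withLoop (_ , suc l) _ = l , refl

empty-arm : ∀ {K} (a : Arm K) → b2n (proj₁ a) ≡ 0 → toℕ (proj₂ a) ≡ 0 → a ≡ empty
empty-arm (false , zero) _ _ = refl

≟empty-counts : ∀ {K} (a : Arm K) → (b2n (proj₁ a) ℕ.≡ᵇ 0) ∧ (toℕ (proj₂ a) ℕ.≡ᵇ 0) ≡ does (a ≟ₐ empty)
≟empty-counts (true  , _)     = refl
≟empty-counts (false , zero)  = refl
≟empty-counts (false , suc _) = refl

data StarEdge {n} : Edge (suc n) → Set where
  spoke : ∀ j → StarEdge (zero , suc j)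
  loop  : ∀ j → StarEdge (suc j , suc j)

module _ {n : ℕ} where

  spoke? : (j : Fin n) → Decidable ((zero , suc j) ≡_)
  spoke? j e = (zero , suc j) ≟ₑ e

  -- Among star edges, those whose first endpoint is v_j are the loops at v_j.
  loop? : (j : Fin n) → Decidable {A = Edge (suc n)} (λ e → suc j ≡ proj₁ e)
  loop? j e = suc j ≟ proj₁ e

  centre? : Decidable {A = Edge (suc n)} (λ e → zero ≡ proj₁ e)
  centre? e = zero ≟ proj₁ e

record _Realises_ {K n k} (es : Vec (Edge (suc n)) k) (p : Vec (Arm K) n) : Set where
  field
    starEdges : All StarEdge es
    spokes    : ∀ j → count (spoke? j) es ≡ b2n (proj₁ (lookup p j))
    loops     : ∀ j → count (loop? j) es ≡ toℕ (proj₂ (lookup p j))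
    centre    : count centre? es ≡ spokeArms p
open _Realises_

module _ {n : ℕ} where

  isolated-centre : ∀ {k} {es : Vec (Edge (suc n)) k} → All StarEdge es →
                    isolated zero es ≡ (count centre? es ℕ.≡ᵇ 0)
  isolated-centre []             = refl
  isolated-centre (spoke _ ∷ _)  = refl
  isolated-centre (loop _ ∷ ses) = isolated-centre ses

  isolated-outer : ∀ {k} {es : Vec (Edge (suc n)) k} → All StarEdge es → ∀ j →
                   isolated (suc j) es ≡ (count (spoke? j) es ℕ.≡ᵇ 0) ∧ (count (loop? j) es ℕ.≡ᵇ 0)
  isolated-outer []                j = refl
  isolated-outer (spoke j′ ∷ ses) j with j ≟ j′
  ... | yes refl = refl
  ... | no _     = isolated-outer ses j
  isolated-outer (loop j′ ∷ ses)  j with j ≟ j′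
  ... | yes refl = sym (∧-zeroʳ _)
  ... | no _     = isolated-outer ses j

module _ {K n : ℕ} (j : Fin n) where

  spoke-removed : (m : Move K) → b2n (proj₁ (source m)) ≡ χ (spoke? j) (removedEdge m j) + b2n (proj₁ (target m))
  spoke-removed (cutSpoke _)  = cong (λ b → b2n b + 0) (sym (dec-true (j ≟ j) refl))
  spoke-removed (cutLoop _ _) = refl

  loop-removed : (m : Move K) → toℕ (proj₂ (source m)) ≡ χ (loop? j) (removedEdge m j) + toℕ (proj₂ (target m))
  loop-removed (cutSpoke _)  = refl
  loop-removed (cutLoop _ l) = sym (cong₂ (λ b t → b2n b + t) (dec-true (j ≟ j) refl) (toℕ-inject₁ l))

  centre-removed : (m : Move K) → b2n (proj₁ (source m)) ≡ χ centre? (removedEdge m j) + b2n (proj₁ (target m))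
  centre-removed (cutSpoke _)  = refl
  centre-removed (cutLoop _ _) = refl

  spoke-elsewhere : ∀ {j′} (m : Move K) → j′ ≢ j → χ (spoke? j′) (removedEdge m j) ≡ 0
  spoke-elsewhere {j′} (cutSpoke _) j′≢j = cong b2n (dec-false (j′ ≟ j) j′≢j)
  spoke-elsewhere      (cutLoop _ _) _   = refl

  loop-elsewhere : ∀ {j′} (m : Move K) → j′ ≢ j → χ (loop? j′) (removedEdge m j) ≡ 0
  loop-elsewhere      (cutSpoke _)  _    = refl
  loop-elsewhere {j′} (cutLoop _ _) j′≢j = cong b2n (dec-false (j′ ≟ j) j′≢j)

module _ {K n} {p : Vec (Arm K) n} {j : Fin n} {m : Move K} (legal : lookup p j ≡ source m) where

  arm-drop : ∀ {ℓ} {Q : Fin n → Pred (Edge (suc n)) ℓ} (Q? : ∀ j → Decidable (Q j)) (f : Arm K → ℕ) →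
             f (source m) ≡ χ (Q? j) (removedEdge m j) + f (target m) →
             (∀ {j′} → j′ ≢ j → χ (Q? j′) (removedEdge m j) ≡ 0) →
             ∀ j′ → f (lookup p j′) ≡ χ (Q? j′) (removedEdge m j) + f (lookup (play p j m) j′)
  arm-drop Q? f atArm elsewhere j′ with j′ ≟ j
  ... | yes refl = begin
    f (lookup p j)
      ≡⟨ cong f legal ⟩
    f (source m)
      ≡⟨ atArm ⟩
    χ (Q? j) (removedEdge m j) + f (target m)
      ≡⟨ cong (λ a → χ (Q? j) (removedEdge m j) + f a) (lookup∘update j p (target m)) ⟨
    χ (Q? j) (removedEdge m j) + f (lookup (play p j m) j) ∎
    where open ≡-Reasoning
  ... | no j′≢j = begin
    f (lookup p j′)
      ≡⟨ cong f (lookup∘update′ j′≢j p (target m)) ⟨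
    f (lookup (play p j m) j′)
      ≡⟨ cong (_+ f (lookup (play p j m) j′)) (elsewhere j′≢j) ⟨
    χ (Q? j′) (removedEdge m j) + f (lookup (play p j m) j′) ∎
    where open ≡-Reasoning

  spokeArms-drop : spokeArms p ≡ χ centre? (removedEdge m j) + spokeArms (play p j m)
  spokeArms-drop = ℕₚ.+-cancelʳ-≡ t _ _ (begin
    spokeArms p + t                              ≡⟨ count-[]≔ (T? ∘ proj₁) p j (target m) ⟨
    spokeArms p′ + b2n (proj₁ (lookup p j))      ≡⟨ cong (λ a → spokeArms p′ + b2n (proj₁ a)) legal ⟩
    spokeArms p′ + b2n (proj₁ (source m))        ≡⟨ cong (_+_ (spokeArms p′)) (centre-removed j m) ⟩
    spokeArms p′ + (c + t)                       ≡⟨ x∙yz≈yx∙z (spokeArms p′) c t ⟩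
    c + spokeArms p′ + t                         ∎)
    where
    open ≡-Reasoning
    p′ = play p j m
    c  = χ centre? (removedEdge m j)
    t  = b2n (proj₁ (target m))

removeAt-realises : ∀ {K n k} {es : Vec (Edge (suc n)) (suc k)} {p : Vec (Arm K) n} {i j m} →
                    es Realises p → lookup p j ≡ source m → lookup es i ≡ removedEdge m j →
                    removeAt es i Realises play p j m
removeAt-realises {n = n} {es = es} {p} {i} {j} {m} r legal removed = record
  { starEdges = All-removeAt (starEdges r) i
  ; spokes    = λ j′ → transfer (spoke? j′) (spokes r j′)
                  (arm-drop {p = p} legal spoke? (b2n ∘ proj₁) (spoke-removed j m) (spoke-elsewhere j m) j′)
  ; loops     = λ j′ → transfer (loop? j′) (loops r j′)
                  (arm-drop {p = p} legal loop? (toℕ ∘ proj₂) (loop-removed j m) (loop-elsewhere j m) j′)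
  ; centre    = transfer centre? (centre r) (spokeArms-drop {p = p} legal)
  }
  where
  transfer : ∀ {ℓ} {Q : Pred (Edge (suc n)) ℓ} (Q? : Decidable Q) {x y} →
             count Q? es ≡ x → x ≡ χ Q? (removedEdge m j) + y → count Q? (removeAt es i) ≡ y
  transfer Q? {x} {y} count≡x x≡ = ℕₚ.+-cancelˡ-≡ (χ Q? (removedEdge m j)) _ _ (begin
    χ Q? (removedEdge m j) + count Q? (removeAt es i)  ≡⟨ cong (λ e → χ Q? e + count Q? (removeAt es i)) removed ⟨
    χ Q? (lookup es i) + count Q? (removeAt es i)      ≡⟨ count-removeAt Q? es i ⟨
    count Q? es                                        ≡⟨ count≡x ⟩
    x                                                  ≡⟨ x≡ ⟩
    χ Q? (removedEdge m j) + y                         ∎)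
    where open ≡-Reasoning

removal⇒move : ∀ {K n k} {es : Vec (Edge (suc n)) (suc k)} {p : Vec (Arm K) n} → es Realises p → ∀ i →
               ∃[ j ] ∃[ m ] lookup p j ≡ source m × lookup es i ≡ removedEdge m j
removal⇒move {es = es} {p} r i = classify (lookup⁺ (starEdges r) i) refl
  where
  classify : ∀ {e} → StarEdge e → lookup es i ≡ e → ∃[ j ] ∃[ m ] lookup p j ≡ source m × lookup es i ≡ removedEdge m j
  classify (spoke j) eᵢ =
    j , cutSpoke _ , withSpoke (lookup p j) (subst ℕ.NonZero (spokes r j) (lookup⇒count-nonZero (spoke? j) es i (sym eᵢ))) , eᵢ
  classify (loop j) eᵢ =
    let l , legal = withLoop (lookup p j) (subst ℕ.NonZero (loops r j) (lookup⇒count-nonZero (loop? j) es i (cong proj₁ (sym eᵢ))))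
    in j , cutLoop _ l , legal , eᵢ

move⇒removal : ∀ {K n k} {es : Vec (Edge (suc n)) k} {p : Vec (Arm K) n} {j m} → es Realises p →
               lookup p j ≡ source m → ∃ λ i → lookup es i ≡ removedEdge m j
move⇒removal {es = es} {j = j} {cutSpoke _} r legal =
  let i , eᵢ = count-nonZero⇒lookup (spoke? j) es (subst ℕ.NonZero (sym (trans (spokes r j) (cong (b2n ∘ proj₁) legal))) _)
  in i , sym eᵢ
move⇒removal {es = es} {j = j} {cutLoop _ _} r legal =
  let i , eᵢ = count-nonZero⇒lookup (loop? j) es (subst ℕ.NonZero (sym (trans (loops r j) (cong (toℕ ∘ proj₂) legal))) _)
  in i , loopAt (lookup⁺ (starEdges r) i) eᵢ
  where
  loopAt : ∀ {e} → StarEdge e → suc j ≡ proj₁ e → e ≡ (suc j , suc j)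
  loopAt (loop _)  refl = refl
  loopAt (spoke _) ()

module _ {K n k} {es : Vec (Edge (suc n)) k} {p : Vec (Arm K) n} (r : es Realises p) where

  isolated-centre-realised : isolated zero es ≡ (spokeArms p ℕ.≡ᵇ 0)
  isolated-centre-realised = trans (isolated-centre (starEdges r)) (cong (ℕ._≡ᵇ 0) (centre r))

  isolated-outer-realised : ∀ j → isolated (suc j) es ≡ does (lookup p j ≟ₐ empty)
  isolated-outer-realised j = begin
    isolated (suc j) es
      ≡⟨ isolated-outer (starEdges r) j ⟩
    (count (spoke? j) es ℕ.≡ᵇ 0) ∧ (count (loop? j) es ℕ.≡ᵇ 0)
      ≡⟨ cong₂ (λ x y → (x ℕ.≡ᵇ 0) ∧ (y ℕ.≡ᵇ 0)) (spokes r j) (loops r j) ⟩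
    (b2n (proj₁ (lookup p j)) ℕ.≡ᵇ 0) ∧ (toℕ (proj₂ (lookup p j)) ℕ.≡ᵇ 0)
      ≡⟨ ≟empty-counts (lookup p j) ⟩
    does (lookup p j ≟ₐ empty) ∎
    where open ≡-Reasoning

realises-[] : ∀ {K n} {p : Vec (Arm K) n} → [] Realises p → p ≡ replicate n empty
realises-[] {n = n} {p} r = begin
  p                                      ≡⟨ tabulate∘lookup p ⟨
  tabulate (lookup p)                    ≡⟨ tabulate-cong lookup≡ ⟩
  tabulate (lookup (replicate n empty))  ≡⟨ tabulate∘lookup _ ⟩
  replicate n empty                      ∎
  where
  open ≡-Reasoning
  lookup≡ : ∀ j → lookup p j ≡ lookup (replicate n empty) j
  lookup≡ j = trans (empty-arm (lookup p j) (sym (spokes r j)) (sym (loops r j))) (sym (lookup-replicate j empty))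

captured-removedEdge : ∀ {K n k} (m : Move K) (j : Fin n) (es : Vec (Edge (suc n)) k) →
                       captured (removedEdge m j) es ≡ b2n (cutsSpoke m ∧ isolated zero es) + b2n (isolated (suc j) es)
captured-removedEdge (cutSpoke _)  j es = refl
captured-removedEdge (cutLoop _ _) j es with j ≟ j
... | yes _   = refl
... | no j≢j = contradiction refl j≢j

removal-captures : ∀ {K n k} {es : Vec (Edge (suc n)) (suc k)} {p : Vec (Arm K) n} {i j m} →
                   es Realises p → lookup p j ≡ source m → lookup es i ≡ removedEdge m j →
                   captured (lookup es i) (removeAt es i) ≡ captures m (spokeArms (play p j m))
removal-captures {es = es} {p} {i} {j} {m} r legal removed = begin
  captured (lookup es i) es′
    ≡⟨ cong (λ e → captured e es′) removed ⟩
  captured (removedEdge m j) es′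
    ≡⟨ captured-removedEdge m j es′ ⟩
  b2n (cutsSpoke m ∧ isolated zero es′) + b2n (isolated (suc j) es′)
    ≡⟨ cong₂ (λ c v → b2n (cutsSpoke m ∧ c) + b2n v) (isolated-centre-realised r′) (isolated-outer-realised r′ j) ⟩
  b2n (cutsSpoke m ∧ (spokeArms p′ ℕ.≡ᵇ 0)) + b2n (does (lookup p′ j ≟ₐ empty))
    ≡⟨ cong (λ a → b2n (cutsSpoke m ∧ (spokeArms p′ ℕ.≡ᵇ 0)) + b2n (does (a ≟ₐ empty))) (lookup∘update j p (target m)) ⟩
  captures m (spokeArms p′) ∎
  where
  open ≡-Reasoning
  es′ = removeAt es i
  p′  = play p j m
  r′  = removeAt-realises r legal removed

module _ {K n : ℕ} (Φ : Vec (Arm K) n → ℤ) where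

  outcome : Vec (Arm K) n → Fin n → Move K → ℤ
  outcome p j m = moveOutcome (captures m (spokeArms (play p j m))) (Φ (play p j m))

  record IsPositionValue : Set where
    field
      terminal : Φ (replicate n empty) ≡ + 0
      bounded  : ∀ p j m → lookup p j ≡ source m → outcome p j m ℤ.≤ Φ p
      attained : ∀ p j m → lookup p j ≡ source m → ∃[ j′ ] ∃[ m′ ] lookup p j′ ≡ source m′ × outcome p j′ m′ ≡ Φ p

  value-realised : IsPositionValue → ∀ {k} {es : Vec (Edge (suc n)) k} {p} → es Realises p → value k es ≡ Φ p
  value-realised V {zero}  {[]}    r = sym (trans (cong Φ (realises-[] r)) (IsPositionValue.terminal V))
  value-realised V {suc k} {es} {p} r = maxFin-≡ upper optimal
    where
    open IsPositionValue V
    removal-outcome : ∀ {i j m} → lookup p j ≡ source m → lookup es i ≡ removedEdge m j → removalValue k es i ≡ outcome p j m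
    removal-outcome {i} legal removed = trans (removalValue-≡ k es i)
      (cong₂ moveOutcome (removal-captures r legal removed) (value-realised V (removeAt-realises r legal removed)))
    upper : ∀ i → removalValue k es i ℤ.≤ Φ p
    upper i = let j , m , legal , removed = removal⇒move r i
              in subst (ℤ._≤ Φ p) (sym (removal-outcome legal removed)) (bounded p j m legal)
    optimal : ∃ λ i → removalValue k es i ≡ Φ p
    optimal = let j₀ , m₀ , legal₀ , _ = removal⇒move r zero
                  j , m , legal , attains = attained p j₀ m₀ legal₀
                  i , removed = move⇒removal r legal
              in i , trans (removal-outcome legal removed) attains

-- Cyclic quotients of ℕ

-- The quotient map of ℕ onto the cyclic monoid of index a and period p: x and x + p are identified once x ≥ a.
cyclic : (a p : ℕ) .{{_ : ℕ.NonZero p}} → ℕ → ℕ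
cyclic zero    p x       = x % p
cyclic (suc a) p zero    = zero
cyclic (suc a) p (suc x) = suc (cyclic a p x)

module _ (p : ℕ) .{{_ : ℕ.NonZero p}} where

  cyclic-< : ∀ a x → cyclic a p x ℕ.< a + p
  cyclic-< zero    x       = m%n<n x p
  cyclic-< (suc a) zero    = s≤s z≤n
  cyclic-< (suc a) (suc x) = s≤s (cyclic-< a x)

  cyclic-≤ : ∀ a x → cyclic a p x ≤ x
  cyclic-≤ zero    x       = m%n≤m x p
  cyclic-≤ (suc a) zero    = z≤n
  cyclic-≤ (suc a) (suc x) = s≤s (cyclic-≤ a x)

  cyclic-suc : ∀ a x → cyclic a p (suc x) ≡ cyclic a p (suc (cyclic a p x))
  cyclic-suc zero    x       = begin
    (1 + x) % p                  ≡⟨ %-distribˡ-+ 1 x p ⟩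
    (1 % p + x % p) % p          ≡⟨ cong (λ y → (1 % p + y) % p) (m%n%n≡m%n x p) ⟨
    (1 % p + x % p % p) % p      ≡⟨ %-distribˡ-+ 1 (x % p) p ⟨
    (1 + x % p) % p              ∎
    where open ≡-Reasoning
  cyclic-suc (suc a) zero    = refl
  cyclic-suc (suc a) (suc x) = cong suc (cyclic-suc a x)

  cyclic-below : ∀ a x → cyclic a p x ℕ.< a → cyclic a p x ≡ x
  cyclic-below (suc a) zero    _   = refl
  cyclic-below (suc a) (suc x) c<a = cong suc (cyclic-below a x (ℕ.s≤s⁻¹ c<a))

  cyclic-≡ᵇ0 : ∀ a x → (cyclic (suc a) p x ℕ.≡ᵇ 0) ≡ (x ℕ.≡ᵇ 0)
  cyclic-≡ᵇ0 a zero    = refl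
  cyclic-≡ᵇ0 a (suc x) = refl

-- Positions of L(n,2)

pattern loops₁ = false , suc zero
pattern loops₂ = false , suc (suc zero)
pattern spoke₀ = true , zero
pattern spoke₁ = true , suc zero
pattern spoke₂ = true , suc (suc zero)

Census : Set
Census = Arm 2 → ℕ

census : ∀ {n} → Vec (Arm 2) n → Census
census p a = count (_≟ₐ a) p

index period : Arm 2 → ℕ
index empty  = 0
index loops₁ = 1
index loops₂ = 1
index spoke₀ = 2
index spoke₁ = 2
index spoke₂ = 3
period empty  = 1
period loops₁ = 1
period loops₂ = 2
period spoke₀ = 1
period spoke₁ = 2
period spoke₂ = 2

period-nonZero : ∀ a → ℕ.NonZero (period a)
period-nonZero empty  = _
period-nonZero loops₁ = _
period-nonZero loops₂ = _
period-nonZero spoke₀ = _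
period-nonZero spoke₁ = _
period-nonZero spoke₂ = _

range : Arm 2 → ℕ
range a = index a + period a

reduce : Arm 2 → ℕ → ℕ
reduce a = cyclic (index a) (period a) {{period-nonZero a}}

reduce-< : ∀ a x → reduce a x ℕ.< range a
reduce-< a = cyclic-< (period a) {{period-nonZero a}} (index a)

reduce-≤ : ∀ a x → reduce a x ≤ x
reduce-≤ a = cyclic-≤ (period a) {{period-nonZero a}} (index a)

reduce-suc : ∀ a x → reduce a (suc x) ≡ reduce a (suc (reduce a x))
reduce-suc a = cyclic-suc (period a) {{period-nonZero a}} (index a)

reduce-below : ∀ a x → reduce a x ℕ.< index a → reduce a x ≡ x
reduce-below a = cyclic-below (period a) {{period-nonZero a}} (index a)

reduce-≡ᵇ0 : ∀ a → a ≢ empty → ∀ x → (reduce a x ℕ.≡ᵇ 0) ≡ (x ℕ.≡ᵇ 0)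
reduce-≡ᵇ0 empty  a≢empty = contradiction refl a≢empty
reduce-≡ᵇ0 loops₁ _       = cyclic-≡ᵇ0 1 0
reduce-≡ᵇ0 loops₂ _       = cyclic-≡ᵇ0 2 0
reduce-≡ᵇ0 spoke₀ _       = cyclic-≡ᵇ0 1 1
reduce-≡ᵇ0 spoke₁ _       = cyclic-≡ᵇ0 2 1
reduce-≡ᵇ0 spoke₂ _       = cyclic-≡ᵇ0 2 2

arms : Vec (Arm 2) 6
arms = empty ∷ loops₁ ∷ loops₂ ∷ spoke₀ ∷ spoke₁ ∷ spoke₂ ∷ []

censusOf : Vec ℕ 6 → Census
censusOf (e ∷ _  ∷ _  ∷ _  ∷ _  ∷ _  ∷ []) empty  = e
censusOf (_ ∷ l₁ ∷ _  ∷ _  ∷ _  ∷ _  ∷ []) loops₁ = l₁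
censusOf (_ ∷ _  ∷ l₂ ∷ _  ∷ _  ∷ _  ∷ []) loops₂ = l₂
censusOf (_ ∷ _  ∷ _  ∷ s₀ ∷ _  ∷ _  ∷ []) spoke₀ = s₀
censusOf (_ ∷ _  ∷ _  ∷ _  ∷ s₁ ∷ _  ∷ []) spoke₁ = s₁
censusOf (_ ∷ _  ∷ _  ∷ _  ∷ _  ∷ s₂ ∷ []) spoke₂ = s₂

classOf : Census → Census
classOf s = censusOf (Vec.map (λ a → reduce a (s a)) arms)

classOf-apply : ∀ s a → classOf s a ≡ reduce a (s a)
classOf-apply s empty  = refl
classOf-apply s loops₁ = refl
classOf-apply s loops₂ = refl
classOf-apply s spoke₀ = refl
classOf-apply s spoke₁ = refl
classOf-apply s spoke₂ = refl

coins spoked : Census → ℕ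
coins  s = s spoke₀ + s loops₁
spoked s = s spoke₀ + s spoke₁ + s spoke₂

coin : Arm 2 → ℕ
coin a = χ (_≟ₐ spoke₀) a + χ (_≟ₐ loops₁) a

correction : Census → ℤ
correction c = table (c spoke₀ ℕ.≡ᵇ 0) (c spoke₁) (c spoke₂) (c loops₂ % 2)
  where
  table : Bool → ℕ → ℕ → ℕ → ℤ
  table true  0 0 0 = 0ℤ
  table false 0 0 0 = 1ℤ
  table _     0 1 0 = 0ℤ
  table _     0 2 0 = -1ℤ
  table true  0 0 1 = -1ℤ
  table false 0 0 1 = 0ℤ
  table _     0 1 1 = 1ℤ
  table _     1 0 1 = 1ℤ
  table _     s₁ s₂ l₂ = if (s₁ + l₂) % 2 ℕ.≡ᵇ 0 then -[1+ 2 ] ℤ.+ + (s₂ % 2) else + 2 ℤ.+ + (s₂ % 2)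

censusValue : Census → ℤ
censusValue s = + coins s ℤ.+ correction (classOf s)

exact : Census → Bool
exact c = (c spoke₀ ℕ.<ᵇ index spoke₀) ∧ (c loops₁ ℕ.<ᵇ index loops₁)

available : Census → Move 2 → Bool
available c m = not (c (source m) ℕ.≡ᵇ 0)

+-≡ᵇ0 : ∀ x y → (x + y ℕ.≡ᵇ 0) ≡ (x ℕ.≡ᵇ 0) ∧ (y ℕ.≡ᵇ 0)
+-≡ᵇ0 zero    _ = refl
+-≡ᵇ0 (suc _) _ = refl

spoked-≡ᵇ0 : ∀ c → (spoked c ℕ.≡ᵇ 0) ≡ ((c spoke₀ ℕ.≡ᵇ 0) ∧ (c spoke₁ ℕ.≡ᵇ 0)) ∧ (c spoke₂ ℕ.≡ᵇ 0)
spoked-≡ᵇ0 c =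
  trans (+-≡ᵇ0 (c spoke₀ + c spoke₁) (c spoke₂)) (cong (_∧ (c spoke₂ ℕ.≡ᵇ 0)) (+-≡ᵇ0 (c spoke₀) (c spoke₁)))

spoked-classOf : ∀ s → (spoked (classOf s) ℕ.≡ᵇ 0) ≡ (spoked s ℕ.≡ᵇ 0)
spoked-classOf s = begin
  spoked (classOf s) ℕ.≡ᵇ 0
    ≡⟨ spoked-≡ᵇ0 (classOf s) ⟩
  ((classOf s spoke₀ ℕ.≡ᵇ 0) ∧ (classOf s spoke₁ ℕ.≡ᵇ 0)) ∧ (classOf s spoke₂ ℕ.≡ᵇ 0)
    ≡⟨ cong₂ _∧_ (cong₂ _∧_ (zero-reflecting _) (zero-reflecting _)) (zero-reflecting _) ⟩
  ((s spoke₀ ℕ.≡ᵇ 0) ∧ (s spoke₁ ℕ.≡ᵇ 0)) ∧ (s spoke₂ ℕ.≡ᵇ 0)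
    ≡⟨ spoked-≡ᵇ0 s ⟨
  spoked s ℕ.≡ᵇ 0 ∎
  where
  open ≡-Reasoning
  zero-reflecting : ∀ l → (reduce (true , l) (s (true , l)) ℕ.≡ᵇ 0) ≡ (s (true , l) ℕ.≡ᵇ 0)
  zero-reflecting l = reduce-≡ᵇ0 (true , l) (λ ()) (s (true , l))

available-classOf : ∀ s m → available (classOf s) m ≡ available s m
available-classOf s m =
  cong not (trans (cong (ℕ._≡ᵇ 0) (classOf-apply s (source m))) (reduce-≡ᵇ0 (source m) (source≢empty m) (s (source m))))

coins-classOf-≤ : ∀ s → coins (classOf s) ≤ coins s
coins-classOf-≤ s = ℕₚ.+-mono-≤ (reduce-≤ spoke₀ (s spoke₀)) (reduce-≤ loops₁ (s loops₁))

coins-exact : ∀ s → T (exact (classOf s)) → coins (classOf s) ≡ coins s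
coins-exact s h = let e₀ , e₁ = Equivalence.to T-∧ h in
  cong₂ _+_ (reduce-below spoke₀ (s spoke₀) (ℕₚ.<ᵇ⇒< _ _ e₀)) (reduce-below loops₁ (s loops₁) (ℕₚ.<ᵇ⇒< _ _ e₁))

correction-cong : ∀ {c c′} → (∀ a → c a ≡ c′ a) → correction c ≡ correction c′
correction-cong c≗c′ rewrite c≗c′ spoke₀ | c≗c′ spoke₁ | c≗c′ spoke₂ | c≗c′ loops₂ = refl

spoked-cong : ∀ {c c′} → (∀ a → c a ≡ c′ a) → spoked c ≡ spoked c′
spoked-cong c≗c′ = cong₂ _+_ (cong₂ _+_ (c≗c′ spoke₀) (c≗c′ spoke₁)) (c≗c′ spoke₂)

captures-cong : ∀ {K} (m : Move K) {x y} → (x ℕ.≡ᵇ 0) ≡ (y ℕ.≡ᵇ 0) → captures m x ≡ captures m y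
captures-cong m eq = cong (λ z → b2n (cutsSpoke m ∧ z) + b2n (does (target m ≟ₐ empty))) eq

record Step (m : Move 2) (s s′ : Census) : Set where
  field
    balance : ∀ a → s′ a + χ (_≟ₐ a) (source m) ≡ s a + χ (_≟ₐ a) (target m)

census-step : ∀ {n} {p : Vec (Arm 2) n} {j m} → lookup p j ≡ source m → Step m (census p) (census (play p j m))
census-step {p = p} {j} {m} legal = record { balance = λ a →
  subst (λ x → census (play p j m) a + χ (_≟ₐ a) x ≡ census p a + χ (_≟ₐ a) (target m)) legal
        (count-[]≔ (_≟ₐ a) p j (target m)) }

successorClass : Move 2 → Census → ℕ → Census
successorClass m c v a =
  if does (source m ≟ₐ a) then v
  else if does (target m ≟ₐ a) then reduce a (suc (c a))
  else c a

module _ {m : Move 2} {s s′ : Census} (step : Step m s s′) where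

  open Step step

  source-decreases : s (source m) ≡ suc (s′ (source m))
  source-decreases = begin
    s (source m)
      ≡⟨ ℕₚ.+-identityʳ _ ⟨
    s (source m) + 0
      ≡⟨ cong (λ b → s (source m) + b2n b) (dec-false (target m ≟ₐ source m) (target≢source m)) ⟨
    s (source m) + χ (_≟ₐ source m) (target m)
      ≡⟨ balance (source m) ⟨
    s′ (source m) + χ (_≟ₐ source m) (source m)
      ≡⟨ cong (λ b → s′ (source m) + b2n b) (dec-true (source m ≟ₐ source m) refl) ⟩
    s′ (source m) + 1
      ≡⟨ ℕₚ.+-comm (s′ (source m)) 1 ⟩
    suc (s′ (source m)) ∎
    where open ≡-Reasoning

  successor-valid : reduce (source m) (suc (classOf s′ (source m))) ≡ classOf s (source m)
  successor-valid = begin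
    reduce (source m) (suc (classOf s′ (source m)))  ≡⟨ cong (reduce (source m) ∘ suc) (classOf-apply s′ (source m)) ⟩
    reduce (source m) (suc (reduce (source m) _))    ≡⟨ reduce-suc (source m) (s′ (source m)) ⟨
    reduce (source m) (suc (s′ (source m)))          ≡⟨ cong (reduce (source m)) source-decreases ⟨
    reduce (source m) (s (source m))                 ≡⟨ classOf-apply s (source m) ⟨
    classOf s (source m)                             ∎
    where open ≡-Reasoning

  coins-step : coins s′ + coin (source m) ≡ coins s + coin (target m)
  coins-step = begin
    (s′ spoke₀ + s′ loops₁) + (χ (_≟ₐ spoke₀) (source m) + χ (_≟ₐ loops₁) (source m))
      ≡⟨ interchange (s′ spoke₀) (s′ loops₁) _ _ ⟩
    (s′ spoke₀ + χ (_≟ₐ spoke₀) (source m)) + (s′ loops₁ + χ (_≟ₐ loops₁) (source m))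
      ≡⟨ cong₂ _+_ (balance spoke₀) (balance loops₁) ⟩
    (s spoke₀ + χ (_≟ₐ spoke₀) (target m)) + (s loops₁ + χ (_≟ₐ loops₁) (target m))
      ≡⟨ interchange (s spoke₀) (s loops₁) _ _ ⟨
    (s spoke₀ + s loops₁) + (χ (_≟ₐ spoke₀) (target m) + χ (_≟ₐ loops₁) (target m)) ∎
    where open ≡-Reasoning

  successorClass-classOf : ∀ a → successorClass m (classOf s) (classOf s′ (source m)) a ≡ classOf s′ a
  successorClass-classOf a with source m ≟ₐ a | target m ≟ₐ a | balance a
  ... | yes refl | _        | _  = refl
  ... | no _     | yes refl | eq = begin
    reduce a (suc (classOf s a))
      ≡⟨ cong (reduce a ∘ suc) (classOf-apply s a) ⟩
    reduce a (suc (reduce a (s a))) ≡⟨ reduce-suc a (s a) ⟨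
    reduce a (suc (s a))
      ≡⟨ cong (reduce a) (trans (sym (ℕₚ.+-identityʳ _)) (trans eq (ℕₚ.+-comm (s a) 1))) ⟨
    reduce a (s′ a)
      ≡⟨ classOf-apply s′ a ⟨
    classOf s′ a ∎
    where open ≡-Reasoning
  ... | no _     | no _     | eq =
    trans (classOf-apply s a) (trans (cong (reduce a) (sym (ℕₚ.+-cancelʳ-≡ 0 _ _ eq))) (sym (classOf-apply s′ a)))

private
  rearrange-capture : ∀ C X′ Dm Dp g′ → C ℤ.+ (X′ ℤ.+ g′) ≡ X′ ℤ.+ Dm ℤ.- Dm ℤ.- Dp ℤ.+ (C ℤ.+ (Dp ℤ.+ g′))
  rearrange-capture = solve-∀

  cancel-capture : ∀ X Dm Dp g → X ℤ.+ Dp ℤ.- Dm ℤ.- Dp ℤ.+ (Dm ℤ.+ g) ≡ X ℤ.+ g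
  cancel-capture = solve-∀

  rearrange-noCapture : ∀ X′ Dm g′ → - (X′ ℤ.+ g′) ≡ Dm ℤ.- (X′ ℤ.+ Dm) ℤ.- g′
  rearrange-noCapture = solve-∀

  cancel-noCapture : ∀ X₀ X Dp g g′ →
                     X₀ ℤ.+ X₀ ℤ.+ Dp ℤ.+ (g ℤ.+ g′) ℤ.- (X ℤ.+ Dp) ℤ.- g′ ≡ X₀ ℤ.+ X₀ ℤ.- X ℤ.+ g
  cancel-noCapture = solve-∀

  cancel-twice : ∀ X g → X ℤ.+ X ℤ.- X ℤ.+ g ≡ X ℤ.+ g
  cancel-twice = solve-∀

-- The optimality inequality and equation for a move capturing k vertices, with corrections g before
-- and g′ after, when the coins change from x to x′ with x′ + dm = x + dp. Without a capture the turn
-- passes and the coins themselves enter: the inequality is stated for a lower bound x₀ ≤ x and the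
-- equation needs x₀ = x.
BoundAt AttainedAt : (k dm dp x₀ : ℕ) (g g′ : ℤ) → Set
BoundAt    zero    dm dp x₀ g g′ = + dm ℤ.≤ + x₀ ℤ.+ + x₀ ℤ.+ + dp ℤ.+ (g ℤ.+ g′)
BoundAt    (suc k) dm dp x₀ g g′ = + suc k ℤ.+ (+ dp ℤ.+ g′) ℤ.≤ + dm ℤ.+ g
AttainedAt zero    dm dp x₀ g g′ = + dm ≡ + x₀ ℤ.+ + x₀ ℤ.+ + dp ℤ.+ (g ℤ.+ g′)
AttainedAt (suc k) dm dp x₀ g g′ = + suc k ℤ.+ (+ dp ℤ.+ g′) ≡ + dm ℤ.+ g

boundAt? : ∀ k dm dp x₀ g g′ → Dec (BoundAt k dm dp x₀ g g′)
boundAt? zero    _ _ _ _ _ = _ ℤₚ.≤? _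
boundAt? (suc k) _ _ _ _ _ = _ ℤₚ.≤? _

attainedAt? : ∀ k dm dp x₀ g g′ → Dec (AttainedAt k dm dp x₀ g g′)
attainedAt? zero    _ _ _ _ _ = _ ℤₚ.≟ _
attainedAt? (suc k) _ _ _ _ _ = _ ℤₚ.≟ _

module _ {dm dp x x′ : ℕ} {g g′ : ℤ} (coins-step : x′ + dm ≡ x + dp) where

  private
    X X′ Dm Dp : ℤ
    X  = + x
    X′ = + x′
    Dm = + dm
    Dp = + dp

    coins-stepℤ : X′ ℤ.+ Dm ≡ X ℤ.+ Dp
    coins-stepℤ = trans (sym (ℤₚ.pos-+ x′ dm)) (trans (cong +_ coins-step) (ℤₚ.pos-+ x dp))

  boundAt-sound : ∀ k {x₀} → x₀ ≤ x → BoundAt k dm dp x₀ g g′ → moveOutcome k (X′ ℤ.+ g′) ℤ.≤ X ℤ.+ g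
  boundAt-sound zero {x₀} x₀≤x bound = begin
    - (X′ ℤ.+ g′)
      ≡⟨ rearrange-noCapture X′ Dm g′ ⟩
    Dm ℤ.- (X′ ℤ.+ Dm) ℤ.- g′
      ≡⟨ cong (λ y → Dm ℤ.- y ℤ.- g′) coins-stepℤ ⟩
    Dm ℤ.- (X ℤ.+ Dp) ℤ.- g′
      ≤⟨ ℤₚ.+-monoˡ-≤ (- g′) (ℤₚ.+-monoˡ-≤ (- (X ℤ.+ Dp)) bound) ⟩
    X₀ ℤ.+ X₀ ℤ.+ Dp ℤ.+ (g ℤ.+ g′) ℤ.- (X ℤ.+ Dp) ℤ.- g′
      ≡⟨ cancel-noCapture X₀ X Dp g g′ ⟩
    X₀ ℤ.+ X₀ ℤ.- X ℤ.+ g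
      ≤⟨ ℤₚ.+-monoˡ-≤ g (ℤₚ.+-monoˡ-≤ (- X) (ℤₚ.+-mono-≤ X₀≤X X₀≤X)) ⟩
    X ℤ.+ X ℤ.- X ℤ.+ g
      ≡⟨ cancel-twice X g ⟩
    X ℤ.+ g ∎
    where
    open ℤₚ.≤-Reasoning
    X₀ = + x₀
    X₀≤X = ℤ.+≤+ x₀≤x
  boundAt-sound (suc k) _ bound = begin
    C ℤ.+ (X′ ℤ.+ g′)
      ≡⟨ rearrange-capture C X′ Dm Dp g′ ⟩
    X′ ℤ.+ Dm ℤ.- Dm ℤ.- Dp ℤ.+ (C ℤ.+ (Dp ℤ.+ g′))
      ≡⟨ cong (λ y → y ℤ.- Dm ℤ.- Dp ℤ.+ (C ℤ.+ (Dp ℤ.+ g′))) coins-stepℤ ⟩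
    X ℤ.+ Dp ℤ.- Dm ℤ.- Dp ℤ.+ (C ℤ.+ (Dp ℤ.+ g′))
      ≤⟨ ℤₚ.+-monoʳ-≤ (X ℤ.+ Dp ℤ.- Dm ℤ.- Dp) bound ⟩
    X ℤ.+ Dp ℤ.- Dm ℤ.- Dp ℤ.+ (Dm ℤ.+ g)
      ≡⟨ cancel-capture X Dm Dp g ⟩
    X ℤ.+ g ∎
    where
    open ℤₚ.≤-Reasoning
    C = + suc k

  attainedAt-sound : ∀ k → AttainedAt k dm dp x g g′ → moveOutcome k (X′ ℤ.+ g′) ≡ X ℤ.+ g
  attainedAt-sound zero attained = begin
    - (X′ ℤ.+ g′)                                       ≡⟨ rearrange-noCapture X′ Dm g′ ⟩
    Dm ℤ.- (X′ ℤ.+ Dm) ℤ.- g′                           ≡⟨ cong₂ (λ y z → y ℤ.- z ℤ.- g′) attained coins-stepℤ ⟩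
    X ℤ.+ X ℤ.+ Dp ℤ.+ (g ℤ.+ g′) ℤ.- (X ℤ.+ Dp) ℤ.- g′  ≡⟨ cancel-noCapture X X Dp g g′ ⟩
    X ℤ.+ X ℤ.- X ℤ.+ g                                 ≡⟨ cancel-twice X g ⟩
    X ℤ.+ g                                             ∎
    where open ≡-Reasoning
  attainedAt-sound (suc k) attained = begin
    C ℤ.+ (X′ ℤ.+ g′)                                ≡⟨ rearrange-capture C X′ Dm Dp g′ ⟩
    X′ ℤ.+ Dm ℤ.- Dm ℤ.- Dp ℤ.+ (C ℤ.+ (Dp ℤ.+ g′))  ≡⟨ cong₂ (λ y z → y ℤ.- Dm ℤ.- Dp ℤ.+ z) coins-stepℤ attained ⟩
    X ℤ.+ Dp ℤ.- Dm ℤ.- Dp ℤ.+ (Dm ℤ.+ g)            ≡⟨ cancel-capture X Dm Dp g ⟩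
    X ℤ.+ g                                          ∎
    where
    open ≡-Reasoning
    C = + suc k

allBelow : ℕ → (ℕ → Bool) → Bool
allBelow n P = all P (upTo n)

allBelow-sound : ∀ {n P x} → T (allBelow n P) → x ℕ.< n → T (P x)
allBelow-sound {n} {P} h x<n = Listᴬ.lookup (all⁺ P (upTo n) h) (∈-upTo⁺ x<n)

allVecs : ∀ {k} → Vec ℕ k → (Vec ℕ k → Bool) → Bool
allVecs []       P = P []
allVecs (b ∷ bs) P = allBelow b λ v → allVecs bs (P ∘ (v ∷_))

allVecs-sound : ∀ {k} {bs : Vec ℕ k} {P} → T (allVecs bs P) → ∀ {vs} → Pointwise ℕ._<_ vs bs → T (P vs)
allVecs-sound {bs = []}     h []              = h
allVecs-sound {bs = b ∷ bs} {P} h (v<b ∷ vs<bs) =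
  allVecs-sound {bs = bs} {P ∘ (_ ∷_)} (allBelow-sound {P = λ v → allVecs bs (P ∘ (v ∷_))} h v<b) vs<bs

allClasses : (Census → Bool) → Bool
allClasses P = allVecs (Vec.map range arms) (P ∘ censusOf)

allClasses-sound : ∀ {P} → T (allClasses P) → ∀ s → T (P (classOf s))
allClasses-sound {P} h s = allVecs-sound {bs = Vec.map range arms} {P ∘ censusOf} h (reduced arms)
  where
  reduced : ∀ {k} (as : Vec (Arm 2) k) → Pointwise ℕ._<_ (Vec.map (λ a → reduce a (s a)) as) (Vec.map range as)
  reduced []       = []
  reduced (a ∷ as) = reduce-< a (s a) ∷ reduced as

moves : List (Move 2)
moves = cutSpoke zero ∷ cutSpoke (suc zero) ∷ cutSpoke (suc (suc zero))
      ∷ cutLoop false zero ∷ cutLoop false (suc zero) ∷ cutLoop true zero ∷ cutLoop true (suc zero) ∷ []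

∈-moves : ∀ m → m ∈ moves
∈-moves (cutSpoke zero)             = here refl
∈-moves (cutSpoke (suc zero))       = there (here refl)
∈-moves (cutSpoke (suc (suc zero))) = there (there (here refl))
∈-moves (cutLoop false zero)        = there (there (there (here refl)))
∈-moves (cutLoop false (suc zero))  = there (there (there (there (here refl))))
∈-moves (cutLoop true zero)         = there (there (there (there (there (here refl)))))
∈-moves (cutLoop true (suc zero))   = there (there (there (there (there (there (here refl))))))

-- The class after m is determined by the class before, except at source m, whose count drops by
-- one: forSuccessors ranges over every class v it may drop to.
forSuccessors : Move 2 → Census → (Census → Bool) → Bool
forSuccessors m c P = allBelow (range (source m)) λ v →
  if reduce (source m) (suc v) ℕ.≡ᵇ c (source m) then P (successorClass m c v) else true

bounded? attained? : Move 2 → Census → Census → Bool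
bounded? m c c′ =
  isYes (boundAt? (captures m (spoked c′)) (coin (source m)) (coin (target m)) (coins c) (correction c) (correction c′))
attained? m c c′ =
  isYes (attainedAt? k (coin (source m)) (coin (target m)) (coins c) (correction c) (correction c′)) ∧ (exact c ∨ not (k ℕ.≡ᵇ 0))
  where k = captures m (spoked c′)

upperBound? optimalMove? : Census → Bool
upperBound?  c = all (λ m → forSuccessors m c (bounded? m c)) moves
optimalMove? c = if any (available c) moves then any (λ m → available c m ∧ forSuccessors m c (attained? m c)) moves else true

-- Both checks are decided by evaluation on all 360 classes.
upperBound-classes : T (allClasses upperBound?)
upperBound-classes = _

optimalMove-classes : T (allClasses optimalMove?)
optimalMove-classes = _

module _ {m : Move 2} {s s′ : Census} (step : Step m s s′) where

  successor : Census
  successor = successorClass m (classOf s) (classOf s′ (source m))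

  successor-check : ∀ {P} → T (forSuccessors m (classOf s) P) → T (P successor)
  successor-check {P} h =
    subst (λ b → T (if b then P successor else true)) (Equivalence.to T-≡ (ℕₚ.≡⇒≡ᵇ _ _ (successor-valid step)))
          (allBelow-sound h class-in-range)
    where
    class-in-range : classOf s′ (source m) ℕ.< range (source m)
    class-in-range = subst (ℕ._< range (source m)) (sym (classOf-apply s′ (source m))) (reduce-< (source m) (s′ (source m)))

  successor-correction : correction successor ≡ correction (classOf s′)
  successor-correction = correction-cong (successorClass-classOf step)

  successor-captures : captures m (spoked successor) ≡ captures m (spoked s′)
  successor-captures = captures-cong m {spoked successor} {spoked s′}
    (trans (cong (ℕ._≡ᵇ 0) (spoked-cong (successorClass-classOf step))) (spoked-classOf s′))

upperBound : ∀ s m → T (forSuccessors m (classOf s) (bounded? m (classOf s)))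
upperBound s m = Listᴬ.lookup (all⁺ (λ m → forSuccessors m (classOf s) (bounded? m (classOf s))) moves
                                    (allClasses-sound {upperBound?} upperBound-classes s)) (∈-moves m)

censusValue-bound : ∀ {m s s′} → Step m s s′ → moveOutcome (captures m (spoked s′)) (censusValue s′) ℤ.≤ censusValue s
censusValue-bound {m} {s} {s′} step =
  subst₂ (λ k g′ → moveOutcome k (+ coins s′ ℤ.+ g′) ℤ.≤ censusValue s) (successor-captures step) (successor-correction step)
    (boundAt-sound (coins-step step) k (coins-classOf-≤ s) bound)
  where
  c′ = successor step
  k  = captures m (spoked c′)
  bound : BoundAt k (coin (source m)) (coin (target m)) (coins (classOf s)) (correction (classOf s)) (correction c′)
  bound = toWitness (successor-check step {bounded? m (classOf s)} (upperBound s m))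

attained-coins : ∀ k {dm dp g g′} s → T (exact (classOf s) ∨ not (k ℕ.≡ᵇ 0)) →
                 AttainedAt k dm dp (coins (classOf s)) g g′ → AttainedAt k dm dp (coins s) g g′
attained-coins zero    {dm} {dp} {g} {g′} s exact =
  subst (λ x → AttainedAt zero dm dp x g g′) (coins-exact s (subst T (∨-identityʳ _) exact))
attained-coins (suc k) s _ attained = attained

censusValue-attained : ∀ {s} m₀ → ℕ.NonZero (s (source m₀)) →
                       ∃ λ m → ℕ.NonZero (s (source m)) ×
                               (∀ {s′} → Step m s s′ → moveOutcome (captures m (spoked s′)) (censusValue s′) ≡ censusValue s)
censusValue-attained {s} m₀ nz₀ = m , record { nonZero = subst T (available-classOf s m) (proj₁ available∧check) } , optimal
  where
  c = classOf s
  optimal? : Move 2 → Bool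
  optimal? m = available c m ∧ forSuccessors m c (attained? m c)
  some-available : any (available c) moves ≡ true
  some-available = Equivalence.to T-≡
    (any⁺ (available c) (lose (∈-moves m₀) (subst T (sym (available-classOf s m₀)) (ℕ.NonZero.nonZero nz₀))))
  some-optimal : ∃ λ m → T (optimal? m)
  some-optimal = satisfied (any⁻ optimal? moves
    (subst (λ b → T (if b then any optimal? moves else true)) some-available (allClasses-sound {optimalMove?} optimalMove-classes s)))
  m = proj₁ some-optimal
  available∧check = Equivalence.to T-∧ (proj₂ some-optimal)
  optimal : ∀ {s′} → Step m s s′ → moveOutcome (captures m (spoked s′)) (censusValue s′) ≡ censusValue s
  optimal {s′} step =
    subst₂ (λ k g′ → moveOutcome k (+ coins s′ ℤ.+ g′) ≡ censusValue s) (successor-captures step) (successor-correction step)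
      (attainedAt-sound (coins-step step) k (attained-coins k s (proj₂ equal∧exact) (toWitness (proj₁ equal∧exact))))
    where
    k = captures m (spoked (successor step))
    equal∧exact = Equivalence.to T-∧ (successor-check step {attained? m c} (proj₂ available∧check))

spokeArms-census : ∀ {n} (p : Vec (Arm 2) n) → spokeArms p ≡ spoked (census p)
spokeArms-census []      = refl
spokeArms-census (a ∷ p) = begin
  spokeArms (a ∷ p)
    ≡⟨ count-∷ (T? ∘ proj₁) a p ⟩
  b2n (proj₁ a) + spokeArms p
    ≡⟨ cong₂ _+_ (spoke-indicator a) (spokeArms-census p) ⟩
  (χ₀ a + χ₁ a + χ₂ a) + (census p spoke₀ + census p spoke₁ + census p spoke₂)
    ≡⟨ rearrange (χ₀ a) (χ₁ a) (χ₂ a) _ _ _ ⟩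
  (χ₀ a + census p spoke₀) + (χ₁ a + census p spoke₁) + (χ₂ a + census p spoke₂)
    ≡⟨ cong₂ _+_ (cong₂ _+_ (count-∷ (_≟ₐ spoke₀) a p) (count-∷ (_≟ₐ spoke₁) a p))
                 (count-∷ (_≟ₐ spoke₂) a p) ⟨
  spoked (census (a ∷ p)) ∎
  where
  open ≡-Reasoning
  χ₀ χ₁ χ₂ : Arm 2 → ℕ
  χ₀ = χ (_≟ₐ spoke₀)
  χ₁ = χ (_≟ₐ spoke₁)
  χ₂ = χ (_≟ₐ spoke₂)
  spoke-indicator : ∀ a → b2n (proj₁ a) ≡ χ₀ a + χ₁ a + χ₂ a
  spoke-indicator empty  = refl
  spoke-indicator loops₁ = refl
  spoke-indicator loops₂ = refl
  spoke-indicator spoke₀ = refl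
  spoke-indicator spoke₁ = refl
  spoke-indicator spoke₂ = refl
  rearrange : ∀ a b c x y z → (a + b + c) + (x + y + z) ≡ (a + x) + (b + y) + (c + z)
  rearrange a b c x y z = trans (interchange (a + b) c (x + y) z) (cong (_+ (c + z)) (interchange a b x y))

censusValue-cong : ∀ {s t} → (∀ a → s a ≡ t a) → censusValue s ≡ censusValue t
censusValue-cong s≗t rewrite s≗t loops₁ | s≗t loops₂ | s≗t spoke₀ | s≗t spoke₁ | s≗t spoke₂ = refl

module _ {n : ℕ} where

  position-terminal : censusValue (census (replicate n empty)) ≡ + 0
  position-terminal = censusValue-cong (λ a → count-replicate (_≟ₐ a) n empty)

  position-bounded : ∀ p j m → lookup p j ≡ source m → outcome (censusValue ∘ census {n}) p j m ℤ.≤ censusValue (census p)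
  position-bounded p j m legal =
    subst (λ x → moveOutcome (captures m x) (censusValue (census (play p j m))) ℤ.≤ censusValue (census p))
          (sym (spokeArms-census (play p j m)))
          (censusValue-bound (census-step {p = p} {j} legal))

  position-attained : ∀ p j₀ m₀ → lookup p j₀ ≡ source m₀ →
                            ∃[ j ] ∃[ m ] lookup p j ≡ source m × outcome (censusValue ∘ census {n}) p j m ≡ censusValue (census p)
  position-attained p j₀ m₀ legal₀ = j , m , legal , optimal-in-p
    where
    attained = censusValue-attained m₀ (lookup⇒count-nonZero (_≟ₐ source m₀) p j₀ legal₀)
    m = proj₁ attained
    located = count-nonZero⇒lookup (_≟ₐ source m) p (proj₁ (proj₂ attained))
    j = proj₁ located
    legal = proj₂ located
    optimal-in-p : outcome (censusValue ∘ census) p j m ≡ censusValue (census p)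
    optimal-in-p =
      subst (λ x → moveOutcome (captures m x) (censusValue (census (play p j m))) ≡ censusValue (census p))
            (sym (spokeArms-census (play p j m)))
            (proj₂ (proj₂ attained) (census-step {p = p} {j} legal))

  censusValue-isPositionValue : IsPositionValue (censusValue ∘ census {n})
  censusValue-isPositionValue = record
    { terminal = position-terminal
    ; bounded  = position-bounded
    ; attained = position-attained
    }

-- The starting position

loopyStar2-realises : ∀ n → loopyStar2 n Realises replicate {A = Arm 2} n spoke₂
loopyStar2-realises n = record
  { starEdges = concat⁺ (tabulate⁺ {P = All StarEdge} λ i → spoke i ∷ loop i ∷ loop i ∷ [])
  ; spokes    = λ j → trans (onlyBlock j (spoke? j) (spokesInBlock j)) (cong (b2n ∘ proj₁) (sym (lookup-replicate j spoke₂)))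
  ; loops     = λ j → trans (onlyBlock j (loop? j) (loopsInBlock j)) (cong (toℕ ∘ proj₂) (sym (lookup-replicate j spoke₂)))
  ; centre    = trans (count-concat centre? block)
                  (trans (sum-tabulate-const n 1) (trans (ℕₚ.*-identityʳ n) (sym (count-replicate (T? ∘ proj₁) n spoke₂))))
  }
  where
  block : Fin n → Vec (Edge (suc n)) 3
  block i = (zero , suc i) ∷ (suc i , suc i) ∷ (suc i , suc i) ∷ []

  spokesInBlock : ∀ j i → count (spoke? j) (block i) ≡ 1 ℕ.* b2n (does (j ≟ i))
  spokesInBlock j i with does (j ≟ i)
  ... | true  = refl
  ... | false = refl

  loopsInBlock : ∀ j i → count (loop? j) (block i) ≡ 2 ℕ.* b2n (does (j ≟ i))
  loopsInBlock j i with does (j ≟ i)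
  ... | true  = refl
  ... | false = refl

  onlyBlock : ∀ j {ℓ} {Q : Pred (Edge (suc n)) ℓ} (Q? : Decidable Q) {c} →
              (∀ i → count Q? (block i) ≡ c ℕ.* b2n (does (j ≟ i))) → count Q? (loopyStar2 n) ≡ c
  onlyBlock j Q? {c} inBlock = begin
    count Q? (concat (tabulate block))
      ≡⟨ count-concat Q? block ⟩
    sum (tabulate (count Q? ∘ block))
      ≡⟨ cong sum (tabulate-cong inBlock) ⟩
    sum (tabulate λ i → c ℕ.* b2n (does (j ≟ i)))
      ≡⟨ sum-single _ j (λ i j≢i → trans (cong (λ b → c ℕ.* b2n b) (dec-false (j ≟ i) j≢i)) (ℕₚ.*-zeroʳ c)) ⟩
    c ℕ.* b2n (does (j ≟ j))
      ≡⟨ cong (λ b → c ℕ.* b2n b) (dec-true (j ≟ j) refl) ⟩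
    c ℕ.* 1
      ≡⟨ ℕₚ.*-identityʳ c ⟩
    c ∎
    where open ≡-Reasoning

gameValueL-census : ∀ n → gameValueL n ≡ censusValue (λ a → if does (spoke₂ ≟ₐ a) then n else 0)
gameValueL-census n =
  trans (value-realised (censusValue ∘ census) censusValue-isPositionValue (loopyStar2-realises n))
        (censusValue-cong λ a → count-replicate (_≟ₐ a) n spoke₂)

gameValueL-≥3 : ∀ m → gameValueL (3 + m) ≡ -[1+ 2 ] ℤ.+ + ((3 + m) % 2)
gameValueL-≥3 m = trans (gameValueL-census (3 + m)) (trans (ℤₚ.+-identityˡ _) (cong (λ r → -[1+ 2 ] ℤ.+ + r) parity))
  where
  parity : (3 + m % 2) % 2 ≡ (3 + m) % 2
  parity = trans (%-distribˡ-+ 3 (m % 2) 2) (trans (cong (λ r → (3 % 2 + r) % 2) (m%n%n≡m%n m 2)) (sym (%-distribˡ-+ 3 m 2)))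

theorem4 : (gameValueL 1 ≡ + 0)
    × (gameValueL 2 ≡ - (+ 1))
    × ((n : ℕ) → 3 ≤ n → n % 2 ≡ 1 → gameValueL n ≡ - (+ 2))
    × ((n : ℕ) → 3 ≤ n → n % 2 ≡ 0 → gameValueL n ≡ - (+ 3))
    × ((n : ℕ) → 2 ≤ n → gameValueL n < + 0)
theorem4 = gameValueL-census 1 , gameValueL-census 2 , odd , even , negative
  where
  odd : (n : ℕ) → 3 ≤ n → n % 2 ≡ 1 → gameValueL n ≡ - (+ 2)
  odd (suc (suc (suc m))) (s≤s (s≤s (s≤s _))) n-odd = trans (gameValueL-≥3 m) (cong (λ r → -[1+ 2 ] ℤ.+ + r) n-odd)
  even : (n : ℕ) → 3 ≤ n → n % 2 ≡ 0 → gameValueL n ≡ - (+ 3)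
  even (suc (suc (suc m))) (s≤s (s≤s (s≤s _))) n-even = trans (gameValueL-≥3 m) (cong (λ r → -[1+ 2 ] ℤ.+ + r) n-even)
  negative : (n : ℕ) → 2 ≤ n → gameValueL n < + 0
  negative 1                   (s≤s ())
  negative 2                   _             = subst (_< + 0) (sym (gameValueL-census 2)) ℤ.-<+
  negative (suc (suc (suc m))) _             = subst (_< + 0) (sym (gameValueL-≥3 m)) (parity-negative (m%n<n (3 + m) 2))
    where
    parity-negative : ∀ {r} → r ℕ.< 2 → -[1+ 2 ] ℤ.+ + r < + 0
    parity-negative {0} _ = ℤ.-<+
    parity-negative {1} _ = ℤ.-<+
    parity-negative {suc (suc _)} (s≤s (s≤s ()))
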